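{- Consider the following graph on the set of words in $\{1,2\}$ (the vertex set of the Young–Fibonacci lattice). Up edges: one edge from $w$ to $w'$ whenever $w'$ covers $w$ in the Young–Fibonacci lattice, plus, at each vertex $X$, a number of loops equal to the number of elements covered by $X$. Down edges: one edge from $X$ to $Y$ whenever $X$ covers $Y$, plus, whenever $X=2Y$, an additional $n-1$ edges from $X$ down to $Y$, where $n$ is the number of elements covered by $X$. Then the associated up and down operators satisfy $DU-UD=D+I$; i.e. this graph is a dual filtered graph.
   Context: The Young–Fibonacci lattice: elements are finite words in $\{1,2\}$, ranked by the sum of letters; $w'$ covers $w$ iff $w'=1w$ or $w'=2v$ for some $v$ covered by $w$. $2Y$ denotes the word obtained by prepending the letter $2$ to $Y$. For a graph with up-edge multiplicities $a_1(x,y)$ (edges from $x$ up to $y$, loops allowed) and down-edge multiplicities $a_2(x,y)$ (edges from $y$ down to $x$), $Ux=\sum_ya_1(x,y)y$ and $Dy=\sum_xa_2(x,y)x$ on formal linear combinations of vertices. -}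

module Defs where

open import Data.Nat using (ℕ; zero; suc; _+_; _∸_)
open import Data.Integer using (ℤ; +_)
import Data.Integer as ℤ
open import Data.List using (List; []; _∷_; map; _++_; concat; length; filter)
open import Data.List.Properties using (≡-dec)
open import Relation.Binary.PropositionalEquality using (_≡_; refl; cong)
open import Relation.Nullary using (Dec; yes; no; ¬_)
open import Relation.Nullary.Decidable using (map′)
open import Relation.Binary.Definitions using (DecidableEquality)

data Letter : Set where
  one two : Letter

_≟L_ : DecidableEquality Letter
one ≟L one = yes refl
one ≟L two = no λ ()
two ≟L one = no λ ()
two ≟L two = yes refl

Word : Set
Word = List Letter

_≟W_ : DecidableEquality Word
_≟W_ = ≡-dec _≟L_

rank : Word → ℕ
rank [] = 0
rank (one ∷ w) = 1 + rank w
rank (two ∷ w) = 2 + rank w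

-- w ⋖ w'  means  w' covers w :
--   w' = 1w, or w' = 2v with v covered by w.
data _⋖_ : Word → Word → Set where
  cov1 : ∀ {w} → w ⋖ (one ∷ w)
  cov2 : ∀ {v w} → v ⋖ w → w ⋖ (two ∷ v)

private
  ⋖-[] : ∀ {v} → ¬ (v ⋖ [])
  ⋖-[] ()

  inv1 : ∀ {w w'} → w ⋖ (one ∷ w') → w ≡ w'
  inv1 cov1 = refl

  inv2 : ∀ {w v} → w ⋖ (two ∷ v) → v ⋖ w
  inv2 (cov2 p) = p

_⋖?_ : (w w' : Word) → Dec (w ⋖ w')
w ⋖? [] = no ⋖-[]
w ⋖? (one ∷ w') = map′ (λ { refl → cov1 }) inv1 (w ≟W w')
[] ⋖? (two ∷ v) = no λ { (cov2 p) → ⋖-[] p }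
(a ∷ w) ⋖? (two ∷ v) = map′ cov2 inv2 (v ⋖? (a ∷ w))

⟦_⟧ : ∀ {P : Set} → Dec P → ℤ
⟦ yes _ ⟧ = + 1
⟦ no _ ⟧ = + 0

wordsOfRank : ℕ → List Word
wordsOfRank 0 = [] ∷ []
wordsOfRank 1 = (one ∷ []) ∷ []
wordsOfRank (suc (suc n)) =
  map (one ∷_) (wordsOfRank (suc n)) ++ map (two ∷_) (wordsOfRank n)

wordsUpTo : ℕ → List Word
wordsUpTo zero = wordsOfRank 0
wordsUpTo (suc n) = wordsUpTo n ++ wordsOfRank (suc n)

Σ[_]_ : List Word → (Word → ℤ) → ℤ
Σ[ [] ] f = + 0
Σ[ y ∷ ys ] f = f y ℤ.+ Σ[ ys ] f

-- number of elements covered by X (every covered element has rank ≤ rank X)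
nCovered : Word → ℤ
nCovered X = Σ[ wordsUpTo (rank X) ] (λ w → ⟦ w ⋖? X ⟧)

a₁ : Word → Word → ℤ
a₁ x y = ⟦ x ⋖? y ⟧ ℤ.+ (⟦ x ≟W y ⟧ ℤ.* nCovered x)

-- a₂ x y : number of down edges from y down to x
--   one edge if y covers x, plus (n - 1) extra edges if y = 2x,
--   where n = number of elements covered by y
a₂ : Word → Word → ℤ
a₂ x y = ⟦ x ⋖? y ⟧ ℤ.+ (⟦ y ≟W (two ∷ x) ⟧ ℤ.* (nCovered y ℤ.- + 1))

LinComb : Set
LinComb = Word → ℤ

δ : Word → LinComb
δ x z = ⟦ z ≟W x ⟧

-- U x = Σ_y a₁(x,y) y ,  D y = Σ_x a₂(x,y) x.
-- Applied to a linear combination f whose support lies in words of rank ≤ r: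
-- (U f)(y) = Σ_x f(x) a₁(x,y),  (D f)(x) = Σ_y a₂(x,y) f(y),
-- summing over all words of rank ≤ r (f vanishes elsewhere).
-- U raises the support bound by 1, D keeps it (D lowers or preserves rank).
Uop : ℕ → LinComb → LinComb
Uop r f y = Σ[ wordsUpTo r ] (λ x → f x ℤ.* a₁ x y)

Dop : ℕ → LinComb → LinComb
Dop r f x = Σ[ wordsUpTo r ] (λ y → a₂ x y ℤ.* f y)

-- Evaluate both sides on a basis vector δ x at z; δ x sifts the finite sums, so
-- DU δx z = Σ_y a₂(z,y) a₁(x,y) and UD δx z = Σ_w a₂(w,x) a₁(w,z).  The key fact is that
-- the down edges out of 2d are exactly the up edges out of d: a₂(z,2d) = a₁(d,z), because
-- 2d covers z iff z covers d, and the n(2d) − 1 = n(d) extra edges from 2d to d match the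
-- n(d) loops at d.  The words covering x are 1x and the 2d with d covered by x, hence
--   DU δx z = [z = x] + Σ_{d ⋖ x} a₁(d,z) + n(x) a₂(z,x),
--   UD δx z = Σ_{d ⋖ x} a₁(d,z) + (n(x) − 1) a₂(z,x),
-- where the last term is the contribution of the extra edges from x = 2w down to w.
-- The difference is a₂(z,x) + [z = x], which is (D + I) δx at z.
module Submission where

open import Defs
open import Data.Nat using (ℕ; suc)
open import Data.Integer using (_+_; _-_)
open import Relation.Binary.PropositionalEquality using (_≡_)

open import Data.Nat as ℕ using (zero; _≤_; _≤?_; s≤s)
import Data.Nat.Properties as ℕ
open import Data.Integer using (ℤ; +_; _*_)
import Data.Integer.Properties as ℤ
open import Data.Integer.Tactic.RingSolver using (solve-∀)
open import Algebra.Properties.CommutativeSemigroup ℤ.+-commutativeSemigroup using (interchange)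
open import Data.List using (List; []; _∷_; map; _++_)
open import Data.List.Properties using (∷-injectiveʳ)
open import Data.List.Relation.Unary.All as All using (All; []; _∷_)
open import Data.List.Relation.Unary.All.Properties using (map⁺)
open import Data.Empty using (⊥-elim)
open import Function using (_∘_)
open import Relation.Binary.PropositionalEquality
  using (_≢_; refl; sym; trans; cong; cong₂; module ≡-Reasoning)
open import Relation.Nullary using (Dec; yes; no; ¬_)

open ≡-Reasoning

⟦⟧-⇔ : {P Q : Set} → (P → Q) → (Q → P) →
       (d : Dec P) (e : Dec Q) → ⟦ d ⟧ ≡ ⟦ e ⟧
⟦⟧-⇔ f g (yes p) (yes q) = refl
⟦⟧-⇔ f g (yes p) (no ¬q) = ⊥-elim (¬q (f p))
⟦⟧-⇔ f g (no ¬p) (yes q) = ⊥-elim (¬p (g q))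
⟦⟧-⇔ f g (no ¬p) (no ¬q) = refl

⟦⟧-no : {P : Set} → ¬ P → (d : Dec P) → ⟦ d ⟧ ≡ + 0
⟦⟧-no ¬p (yes p) = ⊥-elim (¬p p)
⟦⟧-no ¬p (no _)  = refl

⟦⟧-yes : {P : Set} → P → (d : Dec P) → ⟦ d ⟧ ≡ + 1
⟦⟧-yes p (yes _)  = refl
⟦⟧-yes p (no ¬p) = ⊥-elim (¬p p)

δ-∷ : ∀ a (v w : Word) → δ (a ∷ v) (a ∷ w) ≡ δ v w
δ-∷ a v w = ⟦⟧-⇔ ∷-injectiveʳ (cong (a ∷_)) ((a ∷ w) ≟W (a ∷ v)) (w ≟W v)

δ-sym : ∀ v w → δ v w ≡ δ w v
δ-sym v w = ⟦⟧-⇔ sym sym (w ≟W v) (v ≟W w)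

δ-*-eval : ∀ v y (g : Word → ℤ) → δ v y * g y ≡ δ v y * g v
δ-*-eval v y g with y ≟W v
... | yes refl = refl
... | no _     = refl

Σ-cong : ∀ L {f g : Word → ℤ} → (∀ y → f y ≡ g y) → Σ[ L ] f ≡ Σ[ L ] g
Σ-cong []      f≗g = refl
Σ-cong (y ∷ L) f≗g = cong₂ _+_ (f≗g y) (Σ-cong L f≗g)

Σ-zero : ∀ L {f : Word → ℤ} → (∀ y → f y ≡ + 0) → Σ[ L ] f ≡ + 0
Σ-zero []      f≗0 = refl
Σ-zero (y ∷ L) f≗0 = cong₂ _+_ (f≗0 y) (Σ-zero L f≗0)

Σ-+ : ∀ L (f g : Word → ℤ) → Σ[ L ] (λ y → f y + g y) ≡ Σ[ L ] f + Σ[ L ] g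
Σ-+ []      f g = refl
Σ-+ (y ∷ L) f g =
  trans (cong (λ t → f y + g y + t) (Σ-+ L f g)) (interchange (f y) (g y) _ _)

Σ-++ : ∀ A B (f : Word → ℤ) → Σ[ A ++ B ] f ≡ Σ[ A ] f + Σ[ B ] f
Σ-++ []      B f = sym (ℤ.+-identityˡ _)
Σ-++ (y ∷ A) B f = trans (cong (λ t → f y + t) (Σ-++ A B f)) (sym (ℤ.+-assoc (f y) _ _))

Σ-map : ∀ (h : Word → Word) L (f : Word → ℤ) → Σ[ map h L ] f ≡ Σ[ L ] (f ∘ h)
Σ-map h []      f = refl
Σ-map h (y ∷ L) f = cong (λ t → f (h y) + t) (Σ-map h L f)

⟪_⟫ : List Word → LinComb
⟪ L ⟫ v = Σ[ L ] (δ v)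

⟪⟫-++ : ∀ A B v → ⟪ A ++ B ⟫ v ≡ ⟪ A ⟫ v + ⟪ B ⟫ v
⟪⟫-++ A B v = Σ-++ A B (δ v)

⟪map-∷⟫ : ∀ a L (w : Word) → ⟪ map (a ∷_) L ⟫ (a ∷ w) ≡ ⟪ L ⟫ w
⟪map-∷⟫ a L w = trans (Σ-map (a ∷_) L _) (Σ-cong L (δ-∷ a w))

⟪map-∷⟫-other : ∀ a L (v : Word) → (∀ u → v ≢ a ∷ u) → ⟪ map (a ∷_) L ⟫ v ≡ + 0
⟪map-∷⟫-other a L v v≢a∷ =
  trans (Σ-map (a ∷_) L _) (Σ-zero L (λ u → ⟦⟧-no (v≢a∷ u ∘ sym) ((a ∷ u) ≟W v)))

Σ-δ-* : ∀ L v (g : Word → ℤ) → Σ[ L ] (λ y → δ v y * g y) ≡ ⟪ L ⟫ v * g v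
Σ-δ-* []      v g = refl
Σ-δ-* (y ∷ L) v g = begin
  δ v y * g y + Σ[ L ] (λ y → δ v y * g y) ≡⟨ cong₂ _+_ (δ-*-eval v y g) (Σ-δ-* L v g) ⟩
  δ v y * g v + ⟪ L ⟫ v * g v               ≡⟨ ℤ.*-distribʳ-+ (g v) (δ v y) (⟪ L ⟫ v) ⟨
  ⟪ y ∷ L ⟫ v * g v                         ∎

⟦≟⟧-suc : ∀ m n → ⟦ m ℕ.≟ n ⟧ ≡ ⟦ suc m ℕ.≟ suc n ⟧
⟦≟⟧-suc m n = ⟦⟧-⇔ (cong suc) ℕ.suc-injective (m ℕ.≟ n) (suc m ℕ.≟ suc n)

⟪wordsOfRank⟫ : ∀ k v → ⟪ wordsOfRank k ⟫ v ≡ ⟦ rank v ℕ.≟ k ⟧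
⟪wordsOfRank⟫ 0 []        = refl
⟪wordsOfRank⟫ 0 (one ∷ v) = refl
⟪wordsOfRank⟫ 0 (two ∷ v) = refl
⟪wordsOfRank⟫ 1 []              = refl
⟪wordsOfRank⟫ 1 (one ∷ [])      = refl
⟪wordsOfRank⟫ 1 (one ∷ one ∷ v) = refl
⟪wordsOfRank⟫ 1 (one ∷ two ∷ v) = refl
⟪wordsOfRank⟫ 1 (two ∷ v)       = refl
⟪wordsOfRank⟫ (suc (suc k)) v =
  trans (⟪⟫-++ (map (one ∷_) L₁) (map (two ∷_) L₂) v) (split v)
  where
  L₁ = wordsOfRank (suc k)
  L₂ = wordsOfRank k
  split : ∀ v →
    ⟪ map (one ∷_) L₁ ⟫ v + ⟪ map (two ∷_) L₂ ⟫ v ≡ ⟦ rank v ℕ.≟ suc (suc k) ⟧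
  split [] = cong₂ _+_ (⟪map-∷⟫-other one L₁ [] λ _ ()) (⟪map-∷⟫-other two L₂ [] λ _ ())
  split (one ∷ v) = begin
    ⟪ map (one ∷_) L₁ ⟫ (one ∷ v) + ⟪ map (two ∷_) L₂ ⟫ (one ∷ v)
      ≡⟨ cong₂ _+_ (⟪map-∷⟫ one L₁ v) (⟪map-∷⟫-other two L₂ (one ∷ v) λ _ ()) ⟩
    ⟪ L₁ ⟫ v + + 0                      ≡⟨ ℤ.+-identityʳ _ ⟩
    ⟪ L₁ ⟫ v                            ≡⟨ ⟪wordsOfRank⟫ (suc k) v ⟩
    ⟦ rank v ℕ.≟ suc k ⟧                ≡⟨ ⟦≟⟧-suc (rank v) (suc k) ⟩
    ⟦ rank (one ∷ v) ℕ.≟ suc (suc k) ⟧  ∎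
  split (two ∷ v) = begin
    ⟪ map (one ∷_) L₁ ⟫ (two ∷ v) + ⟪ map (two ∷_) L₂ ⟫ (two ∷ v)
      ≡⟨ cong₂ _+_ (⟪map-∷⟫-other one L₁ (two ∷ v) λ _ ()) (⟪map-∷⟫ two L₂ v) ⟩
    + 0 + ⟪ L₂ ⟫ v                      ≡⟨ ℤ.+-identityˡ _ ⟩
    ⟪ L₂ ⟫ v                            ≡⟨ ⟪wordsOfRank⟫ k v ⟩
    ⟦ rank v ℕ.≟ k ⟧                    ≡⟨ ⟦≟⟧-suc (rank v) k ⟩
    ⟦ suc (rank v) ℕ.≟ suc k ⟧          ≡⟨ ⟦≟⟧-suc (suc (rank v)) (suc k) ⟩
    ⟦ rank (two ∷ v) ℕ.≟ suc (suc k) ⟧  ∎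

⟦≤?⟧-suc : ∀ m n → ⟦ m ≤? n ⟧ + ⟦ m ℕ.≟ suc n ⟧ ≡ ⟦ m ≤? suc n ⟧
⟦≤?⟧-suc m n with m ≤? n | m ℕ.≟ suc n | m ≤? suc n
... | yes m≤n | yes refl    | _          = ⊥-elim (ℕ.1+n≰n m≤n)
... | yes _   | no _        | yes _      = refl
... | yes m≤n | no _        | no m≰1+n   = ⊥-elim (m≰1+n (ℕ.m≤n⇒m≤1+n m≤n))
... | no _    | yes _       | yes _      = refl
... | no _    | yes refl    | no m≰1+n   = ⊥-elim (m≰1+n ℕ.≤-refl)
... | no m≰n  | no m≢1+n    | yes m≤1+n  =
  ⊥-elim (m≰n (ℕ.≤-pred (ℕ.≤∧≢⇒< m≤1+n m≢1+n)))
... | no _    | no _        | no _       = refl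

⟪wordsUpTo⟫ : ∀ R v → ⟪ wordsUpTo R ⟫ v ≡ ⟦ rank v ≤? R ⟧
⟪wordsUpTo⟫ zero v = trans (⟪wordsOfRank⟫ 0 v)
  (⟦⟧-⇔ ℕ.≤-reflexive ℕ.n≤0⇒n≡0 (rank v ℕ.≟ 0) (rank v ≤? 0))
⟪wordsUpTo⟫ (suc R) v = begin
  ⟪ wordsUpTo R ++ wordsOfRank (suc R) ⟫ v
    ≡⟨ ⟪⟫-++ (wordsUpTo R) (wordsOfRank (suc R)) v ⟩
  ⟪ wordsUpTo R ⟫ v + ⟪ wordsOfRank (suc R) ⟫ v
    ≡⟨ cong₂ _+_ (⟪wordsUpTo⟫ R v) (⟪wordsOfRank⟫ (suc R) v) ⟩
  ⟦ rank v ≤? R ⟧ + ⟦ rank v ℕ.≟ suc R ⟧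
    ≡⟨ ⟦≤?⟧-suc (rank v) R ⟩
  ⟦ rank v ≤? suc R ⟧ ∎

Σ-siftˡ : ∀ R v (g : Word → ℤ) → rank v ≤ R → Σ[ wordsUpTo R ] (λ y → δ v y * g y) ≡ g v
Σ-siftˡ R v g v≤R = begin
  Σ[ wordsUpTo R ] (λ y → δ v y * g y) ≡⟨ Σ-δ-* (wordsUpTo R) v g ⟩
  ⟪ wordsUpTo R ⟫ v * g v              ≡⟨ cong (_* g v) (⟪wordsUpTo⟫ R v) ⟩
  ⟦ rank v ≤? R ⟧ * g v                ≡⟨ cong (_* g v) (⟦⟧-yes v≤R (rank v ≤? R)) ⟩
  + 1 * g v                            ≡⟨ ℤ.*-identityˡ (g v) ⟩
  g v                                  ∎

Σ-siftʳ : ∀ R v (g : Word → ℤ) → rank v ≤ R → Σ[ wordsUpTo R ] (λ y → g y * δ v y) ≡ g v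
Σ-siftʳ R v g v≤R =
  trans (Σ-cong (wordsUpTo R) (λ y → ℤ.*-comm (g y) (δ v y))) (Σ-siftˡ R v g v≤R)

Σ-sift-⟪⟫ : ∀ R L (h : Word → ℤ) → All (λ u → rank u ≤ R) L →
            Σ[ wordsUpTo R ] (λ y → h y * ⟪ L ⟫ y) ≡ Σ[ L ] h
Σ-sift-⟪⟫ R []      h []           = Σ-zero (wordsUpTo R) (λ y → ℤ.*-zeroʳ (h y))
Σ-sift-⟪⟫ R (u ∷ L) h (u≤R ∷ L≤R) = begin
  Σ[ wordsUpTo R ] (λ y → h y * (δ y u + ⟪ L ⟫ y))
    ≡⟨ Σ-cong (wordsUpTo R) (λ y → trans (cong (λ t → h y * (t + ⟪ L ⟫ y)) (δ-sym y u))
                                         (ℤ.*-distribˡ-+ (h y) (δ u y) (⟪ L ⟫ y))) ⟩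
  Σ[ wordsUpTo R ] (λ y → h y * δ u y + h y * ⟪ L ⟫ y)
    ≡⟨ Σ-+ (wordsUpTo R) _ _ ⟩
  Σ[ wordsUpTo R ] (λ y → h y * δ u y) + Σ[ wordsUpTo R ] (λ y → h y * ⟪ L ⟫ y)
    ≡⟨ cong₂ _+_ (Σ-siftʳ R u h u≤R) (Σ-sift-⟪⟫ R L h L≤R) ⟩
  h u + Σ[ L ] h ∎

covered : Word → List Word
covered []        = []
covered (one ∷ w) = w ∷ []
covered (two ∷ v) = (one ∷ v) ∷ map (two ∷_) (covered v)

covering : Word → List Word
covering x = (one ∷ x) ∷ map (two ∷_) (covered x)

covered-rank : ∀ x → All (λ d → suc (rank d) ≡ rank x) (covered x)
covered-rank []        = []
covered-rank (one ∷ w) = refl ∷ []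
covered-rank (two ∷ v) = refl ∷ map⁺ (All.map (cong (suc ∘ suc)) (covered-rank v))

covered-≤ : ∀ x → All (λ d → rank d ≤ rank x) (covered x)
covered-≤ x = All.map (λ eq → ℕ.≤-trans (ℕ.n≤1+n _) (ℕ.≤-reflexive eq)) (covered-rank x)

covering-≤ : ∀ x → All (λ u → rank u ≤ suc (rank x)) (covering x)
covering-≤ x = ℕ.≤-refl ∷ map⁺ (All.map (s≤s ∘ ℕ.≤-reflexive) (covered-rank x))

⋖-one : ∀ w x → ⟦ w ⋖? (one ∷ x) ⟧ ≡ δ x w
⋖-one w x = ⟦⟧-⇔ (λ { cov1 → refl }) (λ { refl → cov1 }) (w ⋖? (one ∷ x)) (w ≟W x)

⋖-two : ∀ w v → ⟦ w ⋖? (two ∷ v) ⟧ ≡ ⟦ v ⋖? w ⟧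
⋖-two w v = ⟦⟧-⇔ (λ { (cov2 p) → p }) cov2 (w ⋖? (two ∷ v)) (v ⋖? w)

⟪one∷map-two∷⟫-[] : ∀ v L → ⟪ (one ∷ v) ∷ map (two ∷_) L ⟫ [] ≡ + 0
⟪one∷map-two∷⟫-[] v L = trans (ℤ.+-identityˡ _) (⟪map-∷⟫-other two L [] λ _ ())

⟪one∷map-two∷⟫-one : ∀ v L w → ⟪ (one ∷ v) ∷ map (two ∷_) L ⟫ (one ∷ w) ≡ δ w v
⟪one∷map-two∷⟫-one v L w = trans
  (cong₂ _+_ (δ-∷ one w v) (⟪map-∷⟫-other two L (one ∷ w) λ _ ()))
  (ℤ.+-identityʳ (δ w v))

⟪one∷map-two∷⟫-two : ∀ v L w → ⟪ (one ∷ v) ∷ map (two ∷_) L ⟫ (two ∷ w) ≡ ⟪ L ⟫ w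
⟪one∷map-two∷⟫-two v L w = trans
  (cong₂ _+_ (⟦⟧-no (λ ()) ((one ∷ v) ≟W (two ∷ w))) (⟪map-∷⟫ two L w))
  (ℤ.+-identityˡ (⟪ L ⟫ w))

⋖-covered : ∀ x w → ⟦ w ⋖? x ⟧ ≡ ⟪ covered x ⟫ w
⋖-covered []        w = ⟦⟧-no (λ ()) (w ⋖? [])
⋖-covered (one ∷ x) w = begin
  ⟦ w ⋖? (one ∷ x) ⟧              ≡⟨ ⋖-one w x ⟩
  δ x w                           ≡⟨ δ-sym x w ⟩
  δ w x                           ≡⟨ ℤ.+-identityʳ (δ w x) ⟨
  ⟪ x ∷ [] ⟫ w                    ∎
⋖-covered (two ∷ v) [] = begin
  ⟦ [] ⋖? (two ∷ v) ⟧             ≡⟨ ⋖-two [] v ⟩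
  ⟦ v ⋖? [] ⟧                     ≡⟨ ⟦⟧-no (λ ()) (v ⋖? []) ⟩
  + 0                             ≡⟨ ⟪one∷map-two∷⟫-[] v (covered v) ⟨
  ⟪ covered (two ∷ v) ⟫ []        ∎
⋖-covered (two ∷ v) (one ∷ w) = begin
  ⟦ (one ∷ w) ⋖? (two ∷ v) ⟧      ≡⟨ ⋖-two (one ∷ w) v ⟩
  ⟦ v ⋖? (one ∷ w) ⟧              ≡⟨ ⋖-one v w ⟩
  δ w v                           ≡⟨ ⟪one∷map-two∷⟫-one v (covered v) w ⟨
  ⟪ covered (two ∷ v) ⟫ (one ∷ w) ∎
⋖-covered (two ∷ v) (two ∷ w) = begin
  ⟦ (two ∷ w) ⋖? (two ∷ v) ⟧      ≡⟨ ⋖-two (two ∷ w) v ⟩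
  ⟦ v ⋖? (two ∷ w) ⟧              ≡⟨ ⋖-two v w ⟩
  ⟦ w ⋖? v ⟧                      ≡⟨ ⋖-covered v w ⟩
  ⟪ covered v ⟫ w                 ≡⟨ ⟪one∷map-two∷⟫-two v (covered v) w ⟨
  ⟪ covered (two ∷ v) ⟫ (two ∷ w) ∎

⋖-covering : ∀ x y → ⟦ x ⋖? y ⟧ ≡ ⟪ covering x ⟫ y
⋖-covering x [] = begin
  ⟦ x ⋖? [] ⟧                     ≡⟨ ⟦⟧-no (λ ()) (x ⋖? []) ⟩
  + 0                             ≡⟨ ⟪one∷map-two∷⟫-[] x (covered x) ⟨
  ⟪ covering x ⟫ []               ∎
⋖-covering x (one ∷ y) = begin
  ⟦ x ⋖? (one ∷ y) ⟧              ≡⟨ ⋖-one x y ⟩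
  δ y x                           ≡⟨ ⟪one∷map-two∷⟫-one x (covered x) y ⟨
  ⟪ covering x ⟫ (one ∷ y)        ∎
⋖-covering x (two ∷ y) = begin
  ⟦ x ⋖? (two ∷ y) ⟧              ≡⟨ ⋖-two x y ⟩
  ⟦ y ⋖? x ⟧                      ≡⟨ ⋖-covered x y ⟩
  ⟪ covered x ⟫ y                 ≡⟨ ⟪one∷map-two∷⟫-two x (covered x) y ⟨
  ⟪ covering x ⟫ (two ∷ y)        ∎

nCovered-covered : ∀ x → nCovered x ≡ Σ[ covered x ] (λ _ → + 1)
nCovered-covered x = begin
  Σ[ wordsUpTo (rank x) ] (λ w → ⟦ w ⋖? x ⟧)
    ≡⟨ Σ-cong (wordsUpTo (rank x)) (λ w → trans (⋖-covered x w) (sym (ℤ.*-identityˡ _))) ⟩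
  Σ[ wordsUpTo (rank x) ] (λ w → + 1 * ⟪ covered x ⟫ w)
    ≡⟨ Σ-sift-⟪⟫ (rank x) (covered x) (λ _ → + 1) (covered-≤ x) ⟩
  Σ[ covered x ] (λ _ → + 1) ∎

nCovered-one : ∀ w → nCovered (one ∷ w) ≡ + 1
nCovered-one w = nCovered-covered (one ∷ w)

nCovered-two : ∀ v → nCovered (two ∷ v) ≡ + 1 + nCovered v
nCovered-two v = begin
  nCovered (two ∷ v)
    ≡⟨ nCovered-covered (two ∷ v) ⟩
  + 1 + Σ[ map (two ∷_) (covered v) ] (λ _ → + 1)
    ≡⟨ cong (_+_ (+ 1)) (Σ-map (two ∷_) (covered v) _) ⟩
  + 1 + Σ[ covered v ] (λ _ → + 1)
    ≡⟨ cong (_+_ (+ 1)) (nCovered-covered v) ⟨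
  + 1 + nCovered v ∎

a₁-covering : ∀ x y → a₁ x y ≡ ⟪ covering x ⟫ y + δ x y * nCovered x
a₁-covering x y = cong₂ _+_ (⋖-covering x y) (cong (_* nCovered x) (δ-sym y x))

extraDown : Word → Word → ℤ
extraDown x w = ⟦ x ≟W (two ∷ w) ⟧ * (nCovered x - + 1)

extraDown-other : ∀ x w → (∀ v → x ≢ two ∷ v) → extraDown x w ≡ + 0
extraDown-other x w x≢2v = begin
  ⟦ x ≟W (two ∷ w) ⟧ * (nCovered x - + 1)
    ≡⟨ cong (_* (nCovered x - + 1)) (⟦⟧-no (x≢2v w) (x ≟W (two ∷ w))) ⟩
  + 0 * (nCovered x - + 1)
    ≡⟨ ℤ.*-zeroˡ (nCovered x - + 1) ⟩
  + 0 ∎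

a₂-covered : ∀ w x → a₂ w x ≡ ⟪ covered x ⟫ w + extraDown x w
a₂-covered w x = cong (_+ extraDown x w) (⋖-covered x w)

a₂-one : ∀ z x → a₂ z (one ∷ x) ≡ δ x z
a₂-one z x = begin
  ⟦ z ⋖? (one ∷ x) ⟧ + extraDown (one ∷ x) z
    ≡⟨ cong₂ _+_ (⋖-one z x) (extraDown-other (one ∷ x) z λ _ ()) ⟩
  δ x z + + 0
    ≡⟨ ℤ.+-identityʳ (δ x z) ⟩
  δ x z ∎

a₂-two : ∀ z d → a₂ z (two ∷ d) ≡ a₁ d z
a₂-two z d = cong₂ _+_ (⋖-two z d)
  (cong₂ _*_ (δ-∷ two z d)
             (trans (cong (_- + 1) (nCovered-two d)) (1+n-1≡n (nCovered d))))
  where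
  1+n-1≡n : ∀ n → + 1 + n - + 1 ≡ n
  1+n-1≡n = solve-∀

Uop-δ : ∀ r x y → rank x ≤ r → Uop r (δ x) y ≡ a₁ x y
Uop-δ r x y = Σ-siftˡ r x (λ x′ → a₁ x′ y)

Dop-δ : ∀ r x w → rank x ≤ r → Dop r (δ x) w ≡ a₂ w x
Dop-δ r x w = Σ-siftʳ r x (a₂ w)

Σ-covering-a₂ : ∀ x z → Σ[ covering x ] (a₂ z) ≡ δ x z + Σ[ covered x ] (λ d → a₁ d z)
Σ-covering-a₂ x z = cong₂ _+_ (a₂-one z x)
  (trans (Σ-map (two ∷_) (covered x) (a₂ z)) (Σ-cong (covered x) (a₂-two z)))

Σ-extraDown-other : ∀ x (g : Word → ℤ) L → (∀ v → x ≢ two ∷ v) →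
                    Σ[ L ] (λ w → extraDown x w * g w) ≡ + 0
Σ-extraDown-other x g L x≢2v =
  Σ-zero L (λ w → trans (cong (_* g w) (extraDown-other x w x≢2v)) (ℤ.*-zeroˡ (g w)))

Σ-extraDown : ∀ x z →
  Σ[ wordsUpTo (rank x) ] (λ w → extraDown x w * a₁ w z) ≡ a₂ z x * (nCovered x - + 1)
Σ-extraDown [] z =
  trans (Σ-extraDown-other [] (λ w → a₁ w z) (wordsUpTo 0) λ _ ())
        (sym (ℤ.*-zeroˡ (nCovered [] - + 1)))
Σ-extraDown (one ∷ x) z = begin
  Σ[ wordsUpTo (rank (one ∷ x)) ] (λ w → extraDown (one ∷ x) w * a₁ w z)
    ≡⟨ Σ-extraDown-other (one ∷ x) (λ w → a₁ w z) (wordsUpTo (rank (one ∷ x))) (λ _ ()) ⟩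
  + 0
    ≡⟨ ℤ.*-zeroʳ (a₂ z (one ∷ x)) ⟨
  a₂ z (one ∷ x) * (+ 1 - + 1)
    ≡⟨ cong (λ n → a₂ z (one ∷ x) * (n - + 1)) (nCovered-one x) ⟨
  a₂ z (one ∷ x) * (nCovered (one ∷ x) - + 1) ∎
Σ-extraDown (two ∷ v) z = begin
  Σ[ ws ] (λ w → ⟦ (two ∷ v) ≟W (two ∷ w) ⟧ * c * a₁ w z)
    ≡⟨ Σ-cong ws (λ w → cong (λ t → t * c * a₁ w z) (trans (δ-∷ two w v) (δ-sym w v))) ⟩
  Σ[ ws ] (λ w → δ v w * c * a₁ w z)
    ≡⟨ Σ-cong ws (λ w → ℤ.*-assoc (δ v w) c (a₁ w z)) ⟩
  Σ[ ws ] (λ w → δ v w * (c * a₁ w z))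
    ≡⟨ Σ-siftˡ (rank (two ∷ v)) v (λ w → c * a₁ w z) (ℕ.m≤n+m (rank v) 2) ⟩
  c * a₁ v z
    ≡⟨ ℤ.*-comm c (a₁ v z) ⟩
  a₁ v z * c
    ≡⟨ cong (_* c) (a₂-two z v) ⟨
  a₂ z (two ∷ v) * c ∎
  where
  ws = wordsUpTo (rank (two ∷ v))
  c = nCovered (two ∷ v) - + 1

DU-δ : ∀ x z → Dop (suc (rank x)) (Uop (rank x) (δ x)) z
             ≡ δ x z + Σ[ covered x ] (λ d → a₁ d z) + a₂ z x * nCovered x
DU-δ x z = begin
  Σ[ ys ] (λ y → a₂ z y * Uop (rank x) (δ x) y)
    ≡⟨ Σ-cong ys (λ y → cong (a₂ z y *_) (Uop-δ (rank x) x y ℕ.≤-refl)) ⟩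
  Σ[ ys ] (λ y → a₂ z y * a₁ x y)
    ≡⟨ Σ-cong ys (λ y → trans (cong (a₂ z y *_) (a₁-covering x y))
                              (distrib (a₂ z y) _ (δ x y) _)) ⟩
  Σ[ ys ] (λ y → a₂ z y * ⟪ covering x ⟫ y + δ x y * (a₂ z y * nCovered x))
    ≡⟨ Σ-+ ys _ _ ⟩
  Σ[ ys ] (λ y → a₂ z y * ⟪ covering x ⟫ y) + Σ[ ys ] (λ y → δ x y * (a₂ z y * nCovered x))
    ≡⟨ cong₂ _+_ (Σ-sift-⟪⟫ (suc (rank x)) (covering x) (a₂ z) (covering-≤ x))
                 (Σ-siftˡ (suc (rank x)) x (λ y → a₂ z y * nCovered x) (ℕ.n≤1+n (rank x))) ⟩
  Σ[ covering x ] (a₂ z) + a₂ z x * nCovered x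
    ≡⟨ cong (_+ a₂ z x * nCovered x) (Σ-covering-a₂ x z) ⟩
  δ x z + Σ[ covered x ] (λ d → a₁ d z) + a₂ z x * nCovered x ∎
  where
  ys = wordsUpTo (suc (rank x))
  distrib : ∀ a c d n → a * (c + d * n) ≡ a * c + d * (a * n)
  distrib = solve-∀

UD-δ : ∀ x z → Uop (rank x) (Dop (rank x) (δ x)) z
             ≡ Σ[ covered x ] (λ d → a₁ d z) + a₂ z x * (nCovered x - + 1)
UD-δ x z = begin
  Σ[ ws ] (λ w → Dop (rank x) (δ x) w * a₁ w z)
    ≡⟨ Σ-cong ws (λ w → cong (_* a₁ w z) (Dop-δ (rank x) x w ℕ.≤-refl)) ⟩
  Σ[ ws ] (λ w → a₂ w x * a₁ w z)
    ≡⟨ Σ-cong ws (λ w → trans (cong (_* a₁ w z) (a₂-covered w x))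
                              (distrib _ (extraDown x w) (a₁ w z))) ⟩
  Σ[ ws ] (λ w → a₁ w z * ⟪ covered x ⟫ w + extraDown x w * a₁ w z)
    ≡⟨ Σ-+ ws _ _ ⟩
  Σ[ ws ] (λ w → a₁ w z * ⟪ covered x ⟫ w) + Σ[ ws ] (λ w → extraDown x w * a₁ w z)
    ≡⟨ cong₂ _+_ (Σ-sift-⟪⟫ (rank x) (covered x) (λ w → a₁ w z) (covered-≤ x))
                 (Σ-extraDown x z) ⟩
  Σ[ covered x ] (λ d → a₁ d z) + a₂ z x * (nCovered x - + 1) ∎
  where
  ws = wordsUpTo (rank x)
  distrib : ∀ c e a → (c + e) * a ≡ a * c + e * a
  distrib = solve-∀

mainTheorem11 : (x z : Defs.Word) →
    let r = rank x in
    Dop (suc r) (Uop r (δ x)) z - Uop r (Dop r (δ x)) z ≡ Dop r (δ x) z + δ x z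
mainTheorem11 x z = begin
  Dop (suc (rank x)) (Uop (rank x) (δ x)) z - Uop (rank x) (Dop (rank x) (δ x)) z
    ≡⟨ cong₂ _-_ (DU-δ x z) (UD-δ x z) ⟩
  (δ x z + S + a₂ z x * nCovered x) - (S + a₂ z x * (nCovered x - + 1))
    ≡⟨ cancel (δ x z) S (a₂ z x) (nCovered x) ⟩
  a₂ z x + δ x z
    ≡⟨ cong (_+ δ x z) (Dop-δ (rank x) x z ℕ.≤-refl) ⟨
  Dop (rank x) (δ x) z + δ x z ∎
  where
  S = Σ[ covered x ] (λ d → a₁ d z)
  cancel : ∀ e s a n → (e + s + a * n) - (s + a * (n - + 1)) ≡ a + e
  cancel = solve-∀
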